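{- If $D$ is a $(k,n)$-transversal design with $k \leq n$, then $L(D) = \frac{1}{k}$.
   Context: A covering design is a pair $(X,\mathcal{B})$ with $X$ a finite set of points and $\mathcal{B}$ a finite multiset of subsets of $X$ (blocks) such that every pair of distinct points lies together in at least one block; a linear space is one where every pair of distinct points lies in exactly one block. A $(k,n)$-transversal design is a linear space $(X,\mathcal{B})$ with $|X|=kn$ whose blocks consist of $k$ blocks of size $n$ that partition $X$, together with $n^2$ other blocks of size $k$. A weighting of $X$ assigns nonnegative reals to points, $w(S)=\sum_{x\in S}w(x)$, normalised means $w(X)=1$. $L(D,w)=\max\{w(B):B\in\mathcal{B}\}$ and $L(D)$ is the infimum of $L(D,w)$ over all normalised weightings $w$ of $X$.
   Formalization: The weightings of X take nonnegative rational values instead of nonnegative real values, both in the lower bound and in the approximating weightings for L(D). -}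

module Defs where

open import Data.Nat as ℕ using (ℕ; zero; suc)
open import Data.Integer using (+_)
open import Data.Rational using (ℚ; 0ℚ; 1ℚ; _+_; _⊔_; _≤_; _<_; _/_)
open import Data.Fin using (Fin)
open import Data.Fin.Subset using (Subset; _∈_; ∣_∣; ⊤)
open import Data.Vec using (lookup)
open import Data.Bool using (if_then_else_)
open import Data.Product using (Σ; ∃; _×_; Σ-syntax; ∃-syntax)
open import Function.Definitions using (Injective)
open import Relation.Binary.PropositionalEquality using (_≡_; _≢_)

sumFin : (m : ℕ) → (Fin m → ℚ) → ℚ
sumFin zero    f = 0ℚ
sumFin (suc m) f = f Fin.zero + sumFin m (λ i → f (Fin.suc i))
  where import Data.Fin as Fin

-- maximum of f over Fin m (convention: 0 for m = 0; only used for
-- nonnegative values)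
maxFin : (m : ℕ) → (Fin m → ℚ) → ℚ
maxFin zero    f = 0ℚ
maxFin (suc m) f = f Fin.zero ⊔ maxFin m (λ i → f (Fin.suc i))
  where import Data.Fin as Fin

-- A finite design: v points (Fin v) and a multiset of b blocks,
-- given as a family of subsets indexed by Fin b.
record Design : Set where
  field
    v     : ℕ
    b     : ℕ
    block : Fin b → Subset v
open Design public

IsLinearSpace : Design → Set
IsLinearSpace D =
  ∀ (x y : Fin (v D)) → x ≢ y →
    Σ[ i ∈ Fin (b D) ] ((x ∈ block D i × y ∈ block D i)
      × (∀ j → x ∈ block D j → y ∈ block D j → j ≡ i))

IsCovering : Design → Set
IsCovering D =
  ∀ (x y : Fin (v D)) → x ≢ y →
    ∃[ i ] (x ∈ block D i × y ∈ block D i)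

-- (k,n)-transversal design: a linear space on kn points whose blocks are
-- k blocks of size n partitioning X (the image of an injective g) together
-- with n² other blocks of size k.
IsTransversalDesign : ℕ → ℕ → Design → Set
IsTransversalDesign k n D =
  IsLinearSpace D × (v D ≡ k ℕ.* n) × (b D ≡ k ℕ.+ n ℕ.* n) ×
  Σ[ g ∈ (Fin k → Fin (b D)) ]
    ( Injective _≡_ _≡_ g
    × (∀ i → ∣ block D (g i) ∣ ≡ n)
    × (∀ x → Σ[ i ∈ Fin k ] (x ∈ block D (g i) × (∀ i' → x ∈ block D (g i') → i' ≡ i)))
    × (∀ j → (∀ i → g i ≢ j) → ∣ block D j ∣ ≡ k))

Weighting : Design → Set
Weighting D = Fin (v D) → ℚ

wt : (D : Design) → Weighting D → Subset (v D) → ℚ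
wt D w S = sumFin (v D) (λ x → if lookup S x then w x else 0ℚ)

Normalised : (D : Design) → Weighting D → Set
Normalised D w = (∀ x → 0ℚ ≤ w x) × (wt D w ⊤ ≡ 1ℚ)

L[_,_] : (D : Design) → Weighting D → ℚ
L[ D , w ] = maxFin (b D) (λ j → wt D w (block D j))

-- "L(D) = c", i.e. c is the infimum of L(D,w) over normalised weightings w
L≡ : Design → ℚ → Set
L≡ D c =
  (∀ (w : Weighting D) → Normalised D w → c ≤ L[ D , w ]) ×
  (∀ (ε : ℚ) → 0ℚ < ε →
     Σ[ w ∈ Weighting D ] (Normalised D w × L[ D , w ] < c + ε))

-- The k blocks of the parallel class partition the points, so their weights add up to 1 and
-- one of them weighs at least 1/k. Conversely the uniform weighting 1/(kn) gives the blocks of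
-- the parallel class weight n/(kn) = 1/k and the other blocks weight k/(kn) ≤ 1/k, so the
-- infimum 1/k is attained.
module Submission where

open import Defs
open import Data.Nat using (ℕ; _≤_; NonZero)
open import Data.Integer using (+_)
open import Data.Rational using (_/_)

open import Data.Nat as ℕ using (zero; suc)
import Data.Nat.Properties as ℕP
open import Data.Integer as ℤ using (ℤ)
import Data.Integer.Properties as ℤP
open import Data.Integer.Tactic.RingSolver using (solve-∀)
open import Data.Rational as ℚ using (ℚ; 0ℚ; 1ℚ; toℚᵘ)
import Data.Rational.Properties as ℚP
open import Data.Rational.Unnormalised as ℚᵘ using (mkℚᵘ; *≡*; *≤*)
import Data.Rational.Unnormalised.Properties as ℚᵘP
open import Data.Fin as Fin using (Fin; punchIn)
import Data.Fin.Properties as FinP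
open import Data.Fin.Subset using (Subset; _∈_; ∣_∣; ⊤)
import Data.Fin.Subset.Properties as SubsetP
open import Data.Vec using ([]; _∷_; lookup)
import Data.Vec.Properties as VecP
open import Data.Bool using (true; false; if_then_else_)
open import Data.Product using (Σ-syntax; _×_; _,_)
open import Data.Empty using (⊥-elim)
open import Function using (const)
open import Relation.Nullary using (yes; no)
open import Relation.Binary.PropositionalEquality
open import Algebra.Properties.Monoid.Mult ℚP.+-0-monoid using () renaming (_×_ to _·_)
open import Algebra.Properties.CommutativeMonoid.Sum ℚP.+-0-commutativeMonoid
  using (sum; sum-syntax; sum-cong-≗; sum-replicate; sum-replicate-zero; sum-remove; ∑-comm)

toℚᵘ-/ : ∀ a d → toℚᵘ (+ a / suc d) ℚᵘ.≃ mkℚᵘ (+ a) d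
toℚᵘ-/ a d = ℚP.toℚᵘ-fromℚᵘ (mkℚᵘ (+ a) d)

/-cross-≡ : ∀ a b c d → a ℕ.* suc d ≡ c ℕ.* suc b → + a / suc b ≡ + c / suc d
/-cross-≡ a b c d eq = ℚP.toℚᵘ-injective (begin
  toℚᵘ (+ a / suc b) ≈⟨ toℚᵘ-/ a b ⟩
  mkℚᵘ (+ a) b       ≈⟨ *≡* (trans (sym (ℤP.pos-* a (suc d))) (trans (cong +_ eq) (ℤP.pos-* c (suc b)))) ⟩
  mkℚᵘ (+ c) d       ≈⟨ toℚᵘ-/ c d ⟨
  toℚᵘ (+ c / suc d) ∎)
  where open ℚᵘP.≃-Reasoning

/-cross-≤ : ∀ a b c d → a ℕ.* suc d ≤ c ℕ.* suc b → + a / suc b ℚ.≤ + c / suc d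
/-cross-≤ a b c d le = ℚP.toℚᵘ-cancel-≤ (ℚᵘP.≤-respʳ-≃ (ℚᵘP.≃-sym (toℚᵘ-/ c d))
  (ℚᵘP.≤-respˡ-≃ (ℚᵘP.≃-sym (toℚᵘ-/ a b))
    (*≤* (subst₂ ℤ._≤_ (ℤP.pos-* a (suc d)) (ℤP.pos-* c (suc b)) (ℤ.+≤+ le)))))

/-monoˡ-≤ : ∀ {a c} d → a ≤ c → + a / suc d ℚ.≤ + c / suc d
/-monoˡ-≤ {a} {c} d a≤c = /-cross-≤ a d c d (ℕP.*-monoˡ-≤ (suc d) a≤c)

0≤/ : ∀ a d → 0ℚ ℚ.≤ + a / suc d
0≤/ a d = /-cross-≤ 0 0 a d ℕ.z≤n

/-+-sameDenominator : ∀ a c d → + a / suc d ℚ.+ + c / suc d ≡ + (a ℕ.+ c) / suc d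
/-+-sameDenominator a c d = ℚP.toℚᵘ-injective (begin
  toℚᵘ (+ a / suc d ℚ.+ + c / suc d)         ≈⟨ ℚP.toℚᵘ-homo-+ (+ a / suc d) (+ c / suc d) ⟩
  toℚᵘ (+ a / suc d) ℚᵘ.+ toℚᵘ (+ c / suc d) ≈⟨ ℚᵘP.+-cong (toℚᵘ-/ a d) (toℚᵘ-/ c d) ⟩
  mkℚᵘ (+ a) d ℚᵘ.+ mkℚᵘ (+ c) d             ≈⟨ *≡* numerators ⟩
  mkℚᵘ (+ (a ℕ.+ c)) d                       ≈⟨ toℚᵘ-/ (a ℕ.+ c) d ⟨
  toℚᵘ (+ (a ℕ.+ c) / suc d)                 ∎)
  where
  open ℚᵘP.≃-Reasoning
  D = ℤ.+[1+ d ]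
  numerators : (+ a ℤ.* D ℤ.+ + c ℤ.* D) ℤ.* D ≡ + (a ℕ.+ c) ℤ.* (D ℤ.* D)
  numerators = trans (distrib (+ a) (+ c) D) (cong (ℤ._* (D ℤ.* D)) (sym (ℤP.pos-+ a c)))
    where
    distrib : ∀ (x y z : ℤ) → (x ℤ.* z ℤ.+ y ℤ.* z) ℤ.* z ≡ (x ℤ.+ y) ℤ.* (z ℤ.* z)
    distrib = solve-∀

·-1/ : ∀ m d → m · (+ 1 / suc d) ≡ + m / suc d
·-1/ zero    d = sym (ℚP.0/n≡0 (suc d))
·-1/ (suc m) d = trans (cong (+ 1 / suc d ℚ.+_) (·-1/ m d)) (/-+-sameDenominator 1 m d)

·-1/-self : ∀ d → suc d · (+ 1 / suc d) ≡ 1ℚ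
·-1/-self d = trans (·-1/ (suc d) d) (/-cross-≡ (suc d) d 1 0 (ℕP.*-comm (suc d) 1))

·-monoʳ-≤ : ∀ m {p q} → p ℚ.≤ q → m · p ℚ.≤ m · q
·-monoʳ-≤ zero    p≤q = ℚP.≤-refl
·-monoʳ-≤ (suc m) p≤q = ℚP.+-mono-≤ p≤q (·-monoʳ-≤ m p≤q)

·-cancelˡ-≤ : ∀ m {p q} → suc m · p ℚ.≤ suc m · q → p ℚ.≤ q
·-cancelˡ-≤ m {p} {q} mp≤mq with p ℚP.≤? q
... | yes p≤q = p≤q
... | no  p≰q = ⊥-elim (ℚP.<-irrefl refl (ℚP.≤-<-trans mp≤mq mq<mp))
  where
  q<p = ℚP.≰⇒> p≰q
  mq<mp = ℚP.+-mono-<-≤ q<p (·-monoʳ-≤ m (ℚP.<⇒≤ q<p))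

sumFin≡sum : ∀ m (f : Fin m → ℚ) → sumFin m f ≡ sum f
sumFin≡sum zero    f = refl
sumFin≡sum (suc m) f = cong (f Fin.zero ℚ.+_) (sumFin≡sum m (λ i → f (Fin.suc i)))

sum-mono-≤ : ∀ {m} {f g : Fin m → ℚ} → (∀ i → f i ℚ.≤ g i) → sum f ℚ.≤ sum g
sum-mono-≤ {zero}  f≤g = ℚP.≤-refl
sum-mono-≤ {suc m} f≤g = ℚP.+-mono-≤ (f≤g Fin.zero) (sum-mono-≤ (λ i → f≤g (Fin.suc i)))

sum-select : ∀ {m} (f : Fin m → ℚ) i → (∀ j → j ≢ i → f j ≡ 0ℚ) → sum f ≡ f i
sum-select {suc m} f i vanishes = begin
  sum f                                  ≡⟨ sum-remove {i = i} f ⟩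
  f i ℚ.+ sum (λ j → f (punchIn i j))    ≡⟨ cong (f i ℚ.+_) (sum-cong-≗ (λ j → vanishes (punchIn i j) (FinP.punchInᵢ≢i i j))) ⟩
  f i ℚ.+ ∑[ j < m ] 0ℚ                  ≡⟨ cong (f i ℚ.+_) (sum-replicate-zero m) ⟩
  f i ℚ.+ 0ℚ                             ≡⟨ ℚP.+-identityʳ (f i) ⟩
  f i                                    ∎
  where open ≡-Reasoning

maxFin-lub : ∀ m (f : Fin m → ℚ) {c} → 0ℚ ℚ.≤ c → (∀ j → f j ℚ.≤ c) → maxFin m f ℚ.≤ c
maxFin-lub zero    f 0≤c f≤c = 0≤c
maxFin-lub (suc m) f 0≤c f≤c = ℚP.⊔-lub (f≤c Fin.zero) (maxFin-lub m _ 0≤c (λ j → f≤c (Fin.suc j)))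

f≤maxFin : ∀ m (f : Fin m → ℚ) j → f j ℚ.≤ maxFin m f
f≤maxFin (suc m) f Fin.zero    = ℚP.p≤p⊔q _ _
f≤maxFin (suc m) f (Fin.suc j) = ℚP.p≤q⇒p≤r⊔q (f Fin.zero) (f≤maxFin m _ j)

sumFin-indicator-const : ∀ {m} (S : Subset m) c →
  sumFin m (λ x → if lookup S x then c else 0ℚ) ≡ ∣ S ∣ · c
sumFin-indicator-const []          c = refl
sumFin-indicator-const (true  ∷ S) c = cong (c ℚ.+_) (sumFin-indicator-const S c)
sumFin-indicator-const (false ∷ S) c = trans (ℚP.+-identityˡ _) (sumFin-indicator-const S c)

IsPartitionedBy : (D : Design) {k : ℕ} → (Fin k → Fin (b D)) → Set
IsPartitionedBy D {k} g =
  ∀ x → Σ[ i ∈ Fin k ] (x ∈ block D (g i) × (∀ i' → x ∈ block D (g i') → i' ≡ i))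

wt-partition : ∀ (D : Design) {k} {g : Fin k → Fin (b D)} (w : Weighting D) →
  IsPartitionedBy D g → ∑[ i < k ] wt D w (block D (g i)) ≡ wt D w ⊤
wt-partition D {k} {g} w partition = begin
  ∑[ i < k ] wt D w (block D (g i))  ≡⟨ sum-cong-≗ (λ i → sumFin≡sum (v D) (contribution i)) ⟩
  ∑[ i < k ] ∑[ x < v D ] contribution i x  ≡⟨ ∑-comm contribution ⟩
  ∑[ x < v D ] ∑[ i < k ] contribution i x  ≡⟨ sum-cong-≗ contributions ⟩
  ∑[ x < v D ] (if lookup ⊤ x then w x else 0ℚ)  ≡⟨ sumFin≡sum (v D) _ ⟨
  wt D w ⊤  ∎
  where
  open ≡-Reasoning
  contribution : Fin k → Fin (v D) → ℚ
  contribution i x = if lookup (block D (g i)) x then w x else 0ℚ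
  contributions : ∀ x → ∑[ i < k ] contribution i x ≡ (if lookup ⊤ x then w x else 0ℚ)
  contributions x with partition x
  ... | i , x∈gi , unique rewrite VecP.lookup-replicate x true =
    trans (sum-select (λ j → contribution j x) i outside) inside
    where
    outside : ∀ j → j ≢ i → contribution j x ≡ 0ℚ
    outside j j≢i with lookup (block D (g j)) x in x∈gj
    ... | true  = ⊥-elim (j≢i (unique j (VecP.lookup⇒[]= x (block D (g j)) x∈gj)))
    ... | false = refl
    inside : contribution i x ≡ w x
    inside rewrite VecP.[]=⇒lookup x∈gi = refl

L-lower : ∀ (D : Design) {k} {g : Fin (suc k) → Fin (b D)} (w : Weighting D) →
  IsPartitionedBy D g → Normalised D w → + 1 / suc k ℚ.≤ L[ D , w ]
L-lower D {k} {g} w partition (_ , total) = ·-cancelˡ-≤ k (begin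
  suc k · (+ 1 / suc k)                  ≡⟨ ·-1/-self k ⟩
  1ℚ                                     ≡⟨ sym total ⟩
  wt D w ⊤                               ≡⟨ sym (wt-partition D w partition) ⟩
  ∑[ i < suc k ] wt D w (block D (g i))  ≤⟨ sum-mono-≤ (λ i → f≤maxFin (b D) (λ j → wt D w (block D j)) (g i)) ⟩
  ∑[ i < suc k ] L[ D , w ]              ≡⟨ sum-replicate (suc k) {L[ D , w ]} ⟩
  suc k · L[ D , w ]                     ∎)
  where open ℚP.≤-Reasoning

wt-uniform : ∀ (D : Design) N (S : Subset (v D)) → wt D (const (+ 1 / suc N)) S ≡ + ∣ S ∣ / suc N
wt-uniform D N S = trans (sumFin-indicator-const S _) (·-1/ ∣ S ∣ N)

uniform-normalised : ∀ (D : Design) {N} → v D ≡ suc N → Normalised D (const (+ 1 / suc N))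
uniform-normalised D {N} v≡ = (λ _ → 0≤/ 1 N) , (begin
  wt D (const (+ 1 / suc N)) ⊤  ≡⟨ wt-uniform D N ⊤ ⟩
  + ∣ ⊤ {v D} ∣ / suc N          ≡⟨ cong (λ m → + m / suc N) (trans (SubsetP.∣⊤∣≡n (v D)) v≡) ⟩
  + suc N / suc N               ≡⟨ sym (·-1/ (suc N) N) ⟩
  suc N · (+ 1 / suc N)         ≡⟨ ·-1/-self N ⟩
  1ℚ                            ∎)
  where open ≡-Reasoning

L-uniform-≤ : ∀ (D : Design) {N s} → (∀ j → ∣ block D j ∣ ≤ s) →
  L[ D , const (+ 1 / suc N) ] ℚ.≤ + s / suc N
L-uniform-≤ D {N} {s} small = maxFin-lub (b D) _ (0≤/ s N)
  (λ j → ℚP.≤-trans (ℚP.≤-reflexive (wt-uniform D N (block D j))) (/-monoˡ-≤ N (small j)))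

transversal-block-size-≤ : ∀ {k n} (D : Design) → IsTransversalDesign k n D → k ≤ n →
  ∀ j → ∣ block D j ∣ ≤ n
transversal-block-size-≤ D (_ , _ , _ , g , _ , parallel-size , _ , other-size) k≤n j
  with FinP.any? (λ i → g i FinP.≟ j)
... | yes (i , refl) = ℕP.≤-reflexive (parallel-size i)
... | no  j∉g        = ℕP.≤-trans (ℕP.≤-reflexive (other-size j (λ i gi≡j → j∉g (i , gi≡j)))) k≤n

L≡-attained : ∀ (D : Design) {c} → (∀ w → Normalised D w → c ℚ.≤ L[ D , w ]) →
  (w : Weighting D) → Normalised D w → L[ D , w ] ℚ.≤ c → L≡ D c
L≡-attained D {c} lower w normalised L≤c = lower , λ ε ε>0 →
  w , normalised , ℚP.≤-<-trans L≤c (subst (ℚ._< c ℚ.+ ε) (ℚP.+-identityʳ c) (ℚP.+-monoʳ-< c ε>0))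

theorem6p6 : (k n : ℕ) → .{{_ : NonZero k}} → (D : Design) →
    IsTransversalDesign k n D → k ≤ n → L≡ D (+ 1 / k)
theorem6p6 zero n D _ _ = ⊥-elim (ℕ.≢-nonZero⁻¹ zero refl)
theorem6p6 (suc k) (suc n) D td@(_ , v≡kn , _ , _ , _ , _ , partition , _) k≤n =
  L≡-attained D (λ w → L-lower D w partition) uniform (uniform-normalised D v≡kn) (begin
    L[ D , uniform ]              ≤⟨ L-uniform-≤ D (transversal-block-size-≤ D td k≤n) ⟩
    + suc n / (suc k ℕ.* suc n)   ≡⟨ /-cross-≡ (suc n) _ 1 k n/kn≡1/k ⟩
    + 1 / suc k                   ∎)
  where
  open ℚP.≤-Reasoning
  uniform = const (+ 1 / (suc k ℕ.* suc n))
  n/kn≡1/k : suc n ℕ.* suc k ≡ 1 ℕ.* (suc k ℕ.* suc n)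
  n/kn≡1/k = trans (ℕP.*-comm (suc n) (suc k)) (sym (ℕP.*-identityˡ _))
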